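{- For every element $R$ of $B$: $R$ is connected if and only if $R^{\top}$ is connected; and $R$ is a path if and only if $R^{\top}$ is a path.
   Context: $(B,\cup,\mathbin{;},\overline{\,\cdot\,},{}^{\top},{}^{*},\mathsf{I})$ is a Kleene relation algebra; all variables range over $B$. That is, $(B,\cup,\mathbin{;},\overline{\,\cdot\,},{}^{\top},\mathsf{I})$ is a relation algebra: $\cup$ is associative and commutative and $R=\overline{\overline{R}\cup\overline{S}}\cup\overline{\overline{R}\cup S}$; $\mathbin{;}$ is associative, $(R\cup S)\mathbin{;}T=R\mathbin{;}T\cup S\mathbin{;}T$, $R\mathbin{;}\mathsf{I}=R$; $(R^{\top})^{\top}=R$, $(R\cup S)^{\top}=R^{\top}\cup S^{\top}$, $(R\mathbin{;}S)^{\top}=S^{\top}\mathbin{;}R^{\top}$; $R^{\top}\mathbin{;}\overline{R\mathbin{;}S}\cup\overline{S}=\overline{S}$. The order is $R\subseteq S$ iff $R\cup S=S$; $R\cap S=\overline{\overline{R}\cup\overline{S}}$; $\mathsf{L}=R\cup\overline{R}$ is the greatest and $\mathsf{O}=R\cap\overline{R}$ the least element. The star satisfies $\mathsf{I}\cup R\mathbin{;}R^*\subseteq R^*$, $\mathsf{I}\cup R^*\mathbin{;}R\subseteq R^*$, $S\cup R\mathbin{;}Q\subseteq Q\Rightarrow R^*\mathbin{;}S\subseteq Q$, $S\cup Q\mathbin{;}R\subseteq Q\Rightarrow S\mathbin{;}R^*\subseteq Q$. Write $R^{\top*}=(R^{\top})^*$. The algebra satisfies the Tarski rule ($R\neq\mathsf{O}$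 iff $\mathsf{L}\mathbin{;}R\mathbin{;}\mathsf{L}=\mathsf{L}$) and the point axiom (for every $R\neq\mathsf{O}$ there are points $p,q$ with $p\mathbin{;}q^{\top}\subseteq R$), where a point is an element $p$ with $p=p\mathbin{;}\mathsf{L}$, $p\mathbin{;}p^{\top}\subseteq\mathsf{I}$ and $\mathsf{I}\subseteq p^{\top}\mathbin{;}p$. Composition binds tighter than $\cup,\cap$; complement and converse bind tighter than composition. $R$ is univalent if $R^{\top}\mathbin{;}R\subseteq\mathsf{I}$ and injective if $R\mathbin{;}R^{\top}\subseteq\mathsf{I}$. $R$ is connected if $R\mathbin{;}\mathsf{L}\mathbin{;}R\subseteq R^*\cup R^{\top*}$. $R$ is a path if $R$ is injective, univalent and connected. -}

module Defs where

open import Level using (Level; suc)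
open import Relation.Binary.PropositionalEquality using (_≡_)
open import Relation.Nullary using (¬_)
open import Data.Product using (_×_; ∃₂)

record KleeneRelationAlgebra (ℓ : Level) : Set (suc ℓ) where
  infixl 6 _∪_
  infixl 7 _⨾_
  field
    B    : Set ℓ
    _∪_  : B → B → B
    _⨾_  : B → B → B
    ∁    : B → B
    _ᵀ   : B → B
    _⋆   : B → B
    I    : B

  _⊆_ : B → B → Set ℓ
  R ⊆ S = R ∪ S ≡ S

  _∩_ : B → B → B
  R ∩ S = ∁ (∁ R ∪ ∁ S)

  -- greatest element L = R ∪ R̄ (independent of R by the axioms); instantiated at R = I
  𝕃 : B
  𝕃 = I ∪ ∁ I

  𝕆 : B
  𝕆 = I ∩ ∁ I

  field
    ∪-assoc   : ∀ R S T → (R ∪ S) ∪ T ≡ R ∪ (S ∪ T)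
    ∪-comm    : ∀ R S → R ∪ S ≡ S ∪ R
    huntington : ∀ R S → R ≡ ∁ (∁ R ∪ ∁ S) ∪ ∁ (∁ R ∪ S)
    ⨾-assoc   : ∀ R S T → (R ⨾ S) ⨾ T ≡ R ⨾ (S ⨾ T)
    ⨾-distribʳ : ∀ R S T → (R ∪ S) ⨾ T ≡ R ⨾ T ∪ S ⨾ T
    ⨾-identityʳ : ∀ R → R ⨾ I ≡ R
    ᵀ-involutive : ∀ R → (R ᵀ) ᵀ ≡ R
    ᵀ-∪      : ∀ R S → (R ∪ S) ᵀ ≡ R ᵀ ∪ S ᵀ
    ᵀ-⨾      : ∀ R S → (R ⨾ S) ᵀ ≡ S ᵀ ⨾ R ᵀ
    schröder : ∀ R S → (R ᵀ ⨾ ∁ (R ⨾ S)) ∪ ∁ S ≡ ∁ S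
    ⋆-unfoldˡ : ∀ R → (I ∪ R ⨾ (R ⋆)) ⊆ (R ⋆)
    ⋆-unfoldʳ : ∀ R → (I ∪ (R ⋆) ⨾ R) ⊆ (R ⋆)
    ⋆-inductˡ : ∀ R S Q → (S ∪ R ⨾ Q) ⊆ Q → ((R ⋆) ⨾ S) ⊆ Q
    ⋆-inductʳ : ∀ R S Q → (S ∪ Q ⨾ R) ⊆ Q → (S ⨾ (R ⋆)) ⊆ Q

  IsPoint : B → Set ℓ
  IsPoint p = (p ≡ p ⨾ 𝕃) × ((p ⨾ (p ᵀ)) ⊆ I) × (I ⊆ ((p ᵀ) ⨾ p))

  field
    tarski : ∀ R → (¬ (R ≡ 𝕆) → (𝕃 ⨾ R) ⨾ 𝕃 ≡ 𝕃) × ((𝕃 ⨾ R) ⨾ 𝕃 ≡ 𝕃 → ¬ (R ≡ 𝕆))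
    point-axiom : ∀ R → ¬ (R ≡ 𝕆) → ∃₂ λ p q → IsPoint p × IsPoint q × ((p ⨾ (q ᵀ)) ⊆ R)

  Univalent : B → Set ℓ
  Univalent R = ((R ᵀ) ⨾ R) ⊆ I

  Injective : B → Set ℓ
  Injective R = (R ⨾ (R ᵀ)) ⊆ I

  Connected : B → Set ℓ
  Connected R = ((R ⨾ 𝕃) ⨾ R) ⊆ ((R ⋆) ∪ ((R ᵀ) ⋆))

  IsPath : B → Set ℓ
  IsPath R = Injective R × Univalent R × Connected R

-- Converse is an involutive anti-automorphism of composition that preserves ∪ (hence ⊆),
-- fixes 𝕃 and maps R⋆ into Rᵀ⋆ (transpose the star unfolding and apply star induction).
-- Transposing the inclusion R;𝕃;R ⊆ R⋆ ∪ Rᵀ⋆ therefore gives the one for Rᵀ; injectivity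
-- and univalence of R are univalence and injectivity of Rᵀ; and since Rᵀᵀ = R, each
-- implication R ↦ Rᵀ is an equivalence. The only real work is recovering the Boolean
-- algebra facts needed (idempotence, double complement, 𝕃 is the top) from Huntington's axiom.
module Submission where

open import Defs
open import Level using (Level)
open import Data.Product using (_×_; _,_)
open import Function.Bundles using (_⇔_; mk⇔)
open import Relation.Binary.PropositionalEquality
  using (_≡_; sym; trans; cong; cong₂; subst; module ≡-Reasoning)

module Properties {ℓ : Level} (K : KleeneRelationAlgebra ℓ) where
  open KleeneRelationAlgebra K
  open ≡-Reasoning

  Iᵀ≡I : I ᵀ ≡ I
  Iᵀ≡I = begin
    I ᵀ             ≡⟨ sym (⨾-identityʳ (I ᵀ)) ⟩
    I ᵀ ⨾ I         ≡⟨ cong (I ᵀ ⨾_) (sym (ᵀ-involutive I)) ⟩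
    I ᵀ ⨾ (I ᵀ) ᵀ   ≡⟨ sym (ᵀ-⨾ (I ᵀ) I) ⟩
    (I ᵀ ⨾ I) ᵀ     ≡⟨ cong _ᵀ (⨾-identityʳ (I ᵀ)) ⟩
    (I ᵀ) ᵀ         ≡⟨ ᵀ-involutive I ⟩
    I               ∎

  ⨾-identityˡ : ∀ R → I ⨾ R ≡ R
  ⨾-identityˡ R = begin
    I ⨾ R           ≡⟨ cong₂ _⨾_ (sym Iᵀ≡I) (sym (ᵀ-involutive R)) ⟩
    I ᵀ ⨾ (R ᵀ) ᵀ   ≡⟨ sym (ᵀ-⨾ (R ᵀ) I) ⟩
    (R ᵀ ⨾ I) ᵀ     ≡⟨ cong _ᵀ (⨾-identityʳ (R ᵀ)) ⟩
    (R ᵀ) ᵀ         ≡⟨ ᵀ-involutive R ⟩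
    R               ∎

  -- Schröder's axiom instantiated at I.
  ∁-∪-idem : ∀ R → ∁ R ∪ ∁ R ≡ ∁ R
  ∁-∪-idem R = trans (cong (_∪ ∁ R) (sym Iᵀ⨾∁[I⨾R]≡∁R)) (schröder I R)
    where
    Iᵀ⨾∁[I⨾R]≡∁R : I ᵀ ⨾ ∁ (I ⨾ R) ≡ ∁ R
    Iᵀ⨾∁[I⨾R]≡∁R = trans (cong₂ _⨾_ Iᵀ≡I (cong ∁ (⨾-identityˡ R))) (⨾-identityˡ (∁ R))

  ∪-interchange : ∀ R S T U → (R ∪ S) ∪ (T ∪ U) ≡ (R ∪ T) ∪ (S ∪ U)
  ∪-interchange R S T U = begin
    (R ∪ S) ∪ (T ∪ U)   ≡⟨ ∪-assoc R S (T ∪ U) ⟩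
    R ∪ (S ∪ (T ∪ U))   ≡⟨ cong (R ∪_) (sym (∪-assoc S T U)) ⟩
    R ∪ ((S ∪ T) ∪ U)   ≡⟨ cong (λ X → R ∪ (X ∪ U)) (∪-comm S T) ⟩
    R ∪ ((T ∪ S) ∪ U)   ≡⟨ cong (R ∪_) (∪-assoc T S U) ⟩
    R ∪ (T ∪ (S ∪ U))   ≡⟨ sym (∪-assoc R T (S ∪ U)) ⟩
    (R ∪ T) ∪ (S ∪ U)   ∎

  ∪-idem : ∀ R → R ∪ R ≡ R
  ∪-idem R = begin
    R ∪ R               ≡⟨ cong₂ _∪_ (huntington R R) (huntington R R) ⟩
    (P ∪ Q) ∪ (P ∪ Q)   ≡⟨ ∪-interchange P Q P Q ⟩
    (P ∪ P) ∪ (Q ∪ Q)   ≡⟨ cong₂ _∪_ (∁-∪-idem _) (∁-∪-idem _) ⟩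
    P ∪ Q               ≡⟨ sym (huntington R R) ⟩
    R                   ∎
    where
    P = ∁ (∁ R ∪ ∁ R)
    Q = ∁ (∁ R ∪ R)

  ⊆-trans : ∀ {R S T} → R ⊆ S → S ⊆ T → R ⊆ T
  ⊆-trans {R} {S} {T} R⊆S S⊆T = begin
    R ∪ T         ≡⟨ cong (R ∪_) (sym S⊆T) ⟩
    R ∪ (S ∪ T)   ≡⟨ sym (∪-assoc R S T) ⟩
    (R ∪ S) ∪ T   ≡⟨ cong (_∪ T) R⊆S ⟩
    S ∪ T         ≡⟨ S⊆T ⟩
    T             ∎

  ⊆-antisym : ∀ {R S} → R ⊆ S → S ⊆ R → R ≡ S
  ⊆-antisym {R} {S} R⊆S S⊆R = trans (sym S⊆R) (trans (∪-comm S R) R⊆S)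

  ∪-upperˡ : ∀ R S → R ⊆ (R ∪ S)
  ∪-upperˡ R S = trans (sym (∪-assoc R R S)) (cong (_∪ S) (∪-idem R))

  ∪-upperʳ : ∀ R S → S ⊆ (R ∪ S)
  ∪-upperʳ R S = subst (S ⊆_) (∪-comm S R) (∪-upperˡ S R)

  ∪-mono : ∀ {R R′ S S′} → R ⊆ R′ → S ⊆ S′ → (R ∪ S) ⊆ (R′ ∪ S′)
  ∪-mono {R} {R′} {S} {S′} R⊆R′ S⊆S′ = trans (∪-interchange R S R′ S′) (cong₂ _∪_ R⊆R′ S⊆S′)

  ∁∁-split : ∀ R → R ≡ ∁ (∁ R) ∪ ∁ (∁ R ∪ R)
  ∁∁-split R = trans (huntington R R) (cong (λ X → ∁ X ∪ ∁ (∁ R ∪ R)) (∁-∪-idem R))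

  ∁∁-⊆ : ∀ R → ∁ (∁ R) ⊆ R
  ∁∁-⊆ R = subst (∁ (∁ R) ⊆_) (sym (∁∁-split R)) (∪-upperˡ _ _)

  ∁-contrapose : ∀ R S → ∁ R ⊆ S → ∁ S ⊆ R
  ∁-contrapose R S ∁R⊆S = subst (∁ S ⊆_) (sym R≡P∪∁S) (∪-upperʳ _ _)
    where
    R≡P∪∁S : R ≡ ∁ (∁ R ∪ ∁ S) ∪ ∁ S
    R≡P∪∁S = trans (huntington R S) (cong (λ X → ∁ (∁ R ∪ ∁ S) ∪ ∁ X) ∁R⊆S)

  ∁-involutive : ∀ R → ∁ (∁ R) ≡ R
  ∁-involutive R = sym (begin
    R                ≡⟨ ∁∁-split R ⟩
    ∁ (∁ R) ∪ D      ≡⟨ ∪-comm _ D ⟩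
    D ∪ ∁ (∁ R)      ≡⟨ D⊆∁∁R ⟩
    ∁ (∁ R)          ∎)
    where
    D = ∁ (∁ R ∪ R)
    D⊆∁∁R : D ⊆ ∁ (∁ R)
    D⊆∁∁R = ∁-contrapose (∁ (∁ R)) (∁ R ∪ R) (⊆-trans (∁∁-⊆ (∁ R)) (∪-upperˡ (∁ R) R))

  ∁-huntington : ∀ R S → ∁ R ≡ ∁ (R ∪ ∁ S) ∪ ∁ (R ∪ S)
  ∁-huntington R S = trans (huntington (∁ R) S)
    (cong (λ X → ∁ (X ∪ ∁ S) ∪ ∁ (X ∪ S)) (∁-involutive R))

  -- Both sides split into the same four atoms ∁(±R ∪ ±S).
  ∪-∁-invariant : ∀ R S → R ∪ ∁ R ≡ S ∪ ∁ S
  ∪-∁-invariant R S = begin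
    R ∪ ∁ R
      ≡⟨ cong₂ _∪_ (huntington R S) (∁-huntington R S) ⟩
    (∁ (∁ R ∪ ∁ S) ∪ ∁ (∁ R ∪ S)) ∪ (∁ (R ∪ ∁ S) ∪ ∁ (R ∪ S))
      ≡⟨ ∪-interchange _ _ _ _ ⟩
    (∁ (∁ R ∪ ∁ S) ∪ ∁ (R ∪ ∁ S)) ∪ (∁ (∁ R ∪ S) ∪ ∁ (R ∪ S))
      ≡⟨ cong₂ _∪_ (cong₂ _∪_ (∁-∪-comm (∁ R) (∁ S)) (∁-∪-comm R (∁ S)))
                   (cong₂ _∪_ (∁-∪-comm (∁ R) S) (∁-∪-comm R S)) ⟩
    (∁ (∁ S ∪ ∁ R) ∪ ∁ (∁ S ∪ R)) ∪ (∁ (S ∪ ∁ R) ∪ ∁ (S ∪ R))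
      ≡⟨ sym (cong₂ _∪_ (huntington S R) (∁-huntington S R)) ⟩
    S ∪ ∁ S
      ∎
    where
    ∁-∪-comm : ∀ X Y → ∁ (X ∪ Y) ≡ ∁ (Y ∪ X)
    ∁-∪-comm X Y = cong ∁ (∪-comm X Y)

  𝕃-greatest : ∀ R → R ⊆ 𝕃
  𝕃-greatest R = subst (R ⊆_) (∪-∁-invariant R I) (∪-upperˡ R (∁ R))

  ᵀ-mono : ∀ {R S} → R ⊆ S → (R ᵀ) ⊆ (S ᵀ)
  ᵀ-mono {R} {S} R⊆S = trans (sym (ᵀ-∪ R S)) (cong _ᵀ R⊆S)

  𝕃ᵀ≡𝕃 : 𝕃 ᵀ ≡ 𝕃
  𝕃ᵀ≡𝕃 = ⊆-antisym (𝕃-greatest (𝕃 ᵀ))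
    (subst (_⊆ (𝕃 ᵀ)) (ᵀ-involutive 𝕃) (ᵀ-mono (𝕃-greatest (𝕃 ᵀ))))

  -- Transposing the right unfolding of Rᵀ⋆ gives the left star-induction premise for (Rᵀ⋆)ᵀ.
  ⋆ᵀ⊆ᵀ⋆ : ∀ R → ((R ⋆) ᵀ) ⊆ ((R ᵀ) ⋆)
  ⋆ᵀ⊆ᵀ⋆ R = subst (((R ⋆) ᵀ) ⊆_) (ᵀ-involutive ((R ᵀ) ⋆)) (ᵀ-mono R⋆⊆Q)
    where
    Q = ((R ᵀ) ⋆) ᵀ
    unfold-ᵀ : (I ∪ ((R ᵀ) ⋆) ⨾ R ᵀ) ᵀ ≡ I ∪ R ⨾ Q
    unfold-ᵀ = trans (ᵀ-∪ I _)
      (cong₂ _∪_ Iᵀ≡I (trans (ᵀ-⨾ _ _) (cong (_⨾ Q) (ᵀ-involutive R))))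
    I∪R⨾Q⊆Q : (I ∪ R ⨾ Q) ⊆ Q
    I∪R⨾Q⊆Q = subst (_⊆ Q) unfold-ᵀ (ᵀ-mono (⋆-unfoldʳ (R ᵀ)))
    R⋆⊆Q : (R ⋆) ⊆ Q
    R⋆⊆Q = subst (_⊆ Q) (⨾-identityʳ (R ⋆)) (⋆-inductˡ R I Q I∪R⨾Q⊆Q)

  Connected-ᵀ : ∀ R → Connected R → Connected (R ᵀ)
  Connected-ᵀ R connected = ⊆-trans (subst (_⊆ (((R ⋆) ∪ ((R ᵀ) ⋆)) ᵀ)) R𝕃Rᵀ≡Rᵀ𝕃Rᵀ (ᵀ-mono connected))
    (trans (cong (_∪ (((R ᵀ) ⋆) ∪ (((R ᵀ) ᵀ) ⋆))) (ᵀ-∪ (R ⋆) ((R ᵀ) ⋆)))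
           (∪-mono (⋆ᵀ⊆ᵀ⋆ R) (⋆ᵀ⊆ᵀ⋆ (R ᵀ))))
    where
    R𝕃Rᵀ≡Rᵀ𝕃Rᵀ : ((R ⨾ 𝕃) ⨾ R) ᵀ ≡ (R ᵀ ⨾ 𝕃) ⨾ R ᵀ
    R𝕃Rᵀ≡Rᵀ𝕃Rᵀ = begin
      ((R ⨾ 𝕃) ⨾ R) ᵀ     ≡⟨ ᵀ-⨾ _ _ ⟩
      R ᵀ ⨾ (R ⨾ 𝕃) ᵀ     ≡⟨ cong (R ᵀ ⨾_) (ᵀ-⨾ _ _) ⟩
      R ᵀ ⨾ (𝕃 ᵀ ⨾ R ᵀ)   ≡⟨ cong (λ X → R ᵀ ⨾ (X ⨾ R ᵀ)) 𝕃ᵀ≡𝕃 ⟩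
      R ᵀ ⨾ (𝕃 ⨾ R ᵀ)     ≡⟨ sym (⨾-assoc _ _ _) ⟩
      (R ᵀ ⨾ 𝕃) ⨾ R ᵀ     ∎

  IsPath-ᵀ : ∀ R → IsPath R → IsPath (R ᵀ)
  IsPath-ᵀ R (injective , univalent , connected) =
    subst (λ X → (R ᵀ ⨾ X) ⊆ I) (sym (ᵀ-involutive R)) univalent ,
    subst (λ X → (X ⨾ R ᵀ) ⊆ I) (sym (ᵀ-involutive R)) injective ,
    Connected-ᵀ R connected

  ᵀ-invariant : ∀ {p} (P : B → Set p) → (∀ R → P R → P (R ᵀ)) → ∀ R → P R ⇔ P (R ᵀ)
  ᵀ-invariant P P-ᵀ R = mk⇔ (P-ᵀ R) (λ PRᵀ → subst P (ᵀ-involutive R) (P-ᵀ (R ᵀ) PRᵀ))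

mainTheorem1 : ∀ {ℓ : Level} (K : KleeneRelationAlgebra ℓ) →
    let open KleeneRelationAlgebra K in
    ∀ (R : B) → (Connected R ⇔ Connected (R ᵀ)) × (IsPath R ⇔ IsPath (R ᵀ))
mainTheorem1 K R = ᵀ-invariant Connected Connected-ᵀ R , ᵀ-invariant IsPath IsPath-ᵀ R
  where
  open KleeneRelationAlgebra K
  open Properties K
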